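{- Let $G=(V,E)$ be a finite connected simple graph with minimum degree at least $2$. Then there exist two vertices $x,y\in V$ such that $\{x,y\}\in E$ and the induced subgraph $G[V\setminus\{x,y\}]$ is connected. -}

module Defs where

open import Data.Nat using (ℕ; suc; _≤_)
open import Data.Fin using (Fin)
open import Data.Bool using (Bool; true; false)
open import Data.List using (List; filter; length)
open import Data.Fin.Base using () 
open import Data.List using (allFin)
open import Relation.Binary.PropositionalEquality using (_≡_)
open import Relation.Nullary using (¬_)
open import Data.Bool.Properties using (T?)
open import Data.Bool using (T)
open import Data.Product using (_×_)
open import Data.Unit using (⊤)

record SimpleGraph (n : ℕ) : Set where
  field
    adj   : Fin n → Fin n → Bool
    sym   : ∀ u v → adj u v ≡ adj v u
    loopless : ∀ v → adj v v ≡ false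

open SimpleGraph public

Adj : ∀ {n} → SimpleGraph n → Fin n → Fin n → Set
Adj G u v = T (adj G u v)

degree : ∀ {n} → SimpleGraph n → Fin n → ℕ
degree {n} G v = length (filter (λ u → T? (adj G v u)) (allFin n))

-- Walks in G all of whose vertices satisfy the predicate S
-- (i.e. walks in the induced subgraph G[S]).
data WalkIn {n : ℕ} (G : SimpleGraph n) (S : Fin n → Set) : Fin n → Fin n → Set where
  stop : ∀ {u} → S u → WalkIn G S u u
  step : ∀ {u v w} → S u → Adj G u v → WalkIn G S v w → WalkIn G S u w

ConnectedOn : ∀ {n} → SimpleGraph n → (Fin n → Set) → Set
ConnectedOn {n} G S = ∀ (u v : Fin n) → S u → S v → WalkIn G S u v

All : ∀ {n} → Fin n → Set
All _ = ⊤

Connected : ∀ {n} → SimpleGraph n → Set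
Connected G = ConnectedOn G All

Minus2 : ∀ {n} → Fin n → Fin n → Fin n → Set
Minus2 x y v = ¬ (v ≡ x) × ¬ (v ≡ y)

-- Grow a connected vertex set S avoiding an edge xy, one vertex at a time.
-- If some vertex outside S ∪ {x, y} is adjacent to S, add it. Otherwise take a
-- vertex z outside S ∪ {x, y}; a walk from S to z leaves S through x or y, say
-- through b. A neighbour w ≠ b of z (it exists as deg z ≥ 2) either lies in S,
-- so that z is adjacent to S after all, or lies outside S, and then zw is a new
-- edge avoided by S ∪ {b}. Each step shrinks the complement of S, so the
-- process stops, and it can only stop when S = V ∖ {x, y}.
module Submission where

open import Defs hiding (All; sym)
open import Data.Nat using (ℕ; suc; _≤_; _<_; z≤n; s≤s)
open import Data.Nat.Induction using (<-wellFounded)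
open import Data.Nat.Properties using (<-irrefl; ≤-trans; m≤n⇒m≤1+n; m<n⇒m<1+n)
open import Data.Fin using (Fin; zero; _≟_)
open import Data.Fin.Properties using (any?)
open import Data.Product using (Σ; ∃; ∃₂; _×_; _,_)
open import Data.Sum using (_⊎_; inj₁; inj₂)
open import Data.Unit using (tt)
open import Data.Bool using (T)
open import Data.Bool.Properties using (T?)
open import Data.List using (List; []; _∷_; filter; length; allFin)
open import Data.List.Membership.Propositional using (_∈_)
open import Data.List.Membership.Propositional.Properties using (∈-allFin)
import Data.List.Relation.Unary.All as All
open All using (All; []; _∷_)
open import Data.List.Relation.Unary.All.Properties using (all-filter)
open import Data.List.Relation.Unary.Any using (here; there)
open import Data.List.Relation.Unary.AllPairs using ([]; _∷_)
open import Data.List.Relation.Unary.Unique.Propositional using (Unique)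
open import Data.List.Relation.Unary.Unique.Propositional.Properties using (allFin⁺; filter⁺)
open import Induction.WellFounded using (Acc; acc)
open import Relation.Binary.Construct.On using (wellFounded)
open import Relation.Binary.PropositionalEquality using (_≡_; _≢_; refl; sym; subst)
open import Relation.Nullary using (¬_; yes; no; ¬?; contradiction)
open import Relation.Nullary.Decidable using (_×-dec_; decidable-stable)
open import Relation.Unary using (Pred; Decidable; _∪_; ｛_｝)
open import Relation.Unary.Properties using (∁?; _∪?_)

module _ {a p} {A : Set a} {P Q : Pred A p} (P? : Decidable P) (Q? : Decidable Q)
         (P⊆Q : ∀ {x} → P x → Q x) where

  length-filter-mono : ∀ xs → length (filter P? xs) ≤ length (filter Q? xs)
  length-filter-mono []       = z≤n
  length-filter-mono (x ∷ xs) with P? x | Q? x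
  ... | yes _  | yes _  = s≤s (length-filter-mono xs)
  ... | yes px | no ¬qx = contradiction (P⊆Q px) ¬qx
  ... | no _   | yes _  = m≤n⇒m≤1+n (length-filter-mono xs)
  ... | no _   | no _   = length-filter-mono xs

  length-filter-strict : ∀ {t xs} → t ∈ xs → Q t → ¬ P t →
                         length (filter P? xs) < length (filter Q? xs)
  length-filter-strict {xs = x ∷ xs} (here refl) qt ¬pt with P? x | Q? x
  ... | yes pt | _      = contradiction pt ¬pt
  ... | no _   | yes _  = s≤s (length-filter-mono xs)
  ... | no _   | no ¬qt = contradiction qt ¬qt
  length-filter-strict {xs = x ∷ xs} (there t∈xs) qt ¬pt with P? x | Q? x
  ... | yes _  | yes _  = s≤s (length-filter-strict t∈xs qt ¬pt)
  ... | yes px | no ¬qx = contradiction (P⊆Q px) ¬qx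
  ... | no _   | yes _  = m<n⇒m<1+n (length-filter-strict t∈xs qt ¬pt)
  ... | no _   | no _   = length-filter-strict t∈xs qt ¬pt

unique-constant-length≤1 : ∀ {a} {A : Set a} {t : A} {xs : List A} →
                           Unique xs → All (_≡ t) xs → length xs ≤ 1
unique-constant-length≤1 []               []                = z≤n
unique-constant-length≤1 (_ ∷ [])         (_ ∷ [])          = s≤s z≤n
unique-constant-length≤1 ((x≢y ∷ _) ∷ _) (refl ∷ refl ∷ _) = contradiction refl x≢y

module _ {n} (G : SimpleGraph n) where

  adj-sym : ∀ {u v} → Adj G u v → Adj G v u
  adj-sym {u} {v} = subst T (SimpleGraph.sym G u v)

  adj-irrefl : ∀ {u v} → Adj G u v → u ≢ v
  adj-irrefl {u} u~u refl = subst T (loopless G u) u~u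

  degree≤1 : ∀ {v} t → (∀ {u} → Adj G v u → u ≡ t) → degree G v ≤ 1
  degree≤1 {v} t only-t = unique-constant-length≤1
    (filter⁺ (λ u → T? (adj G v u)) (allFin⁺ n))
    (All.map only-t (all-filter (λ u → T? (adj G v u)) (allFin n)))

  other-neighbour : ∀ {v} → 2 ≤ degree G v → ∀ t → ∃ λ u → Adj G v u × u ≢ t
  other-neighbour {v} deg t with any? (λ u → T? (adj G v u) ×-dec ¬? (u ≟ t))
  ... | yes (u , v~u , u≢t) = u , v~u , u≢t
  ... | no none = contradiction (≤-trans deg (degree≤1 t only-t)) (<-irrefl refl)
    where
    only-t : ∀ {u} → Adj G v u → u ≡ t
    only-t {u} v~u = decidable-stable (u ≟ t) (λ u≢t → none (u , v~u , u≢t))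

module _ {n} {G : SimpleGraph n} where

  walk-mono : ∀ {P Q : Fin n → Set} → (∀ {v} → P v → Q v) →
              ∀ {u w} → WalkIn G P u w → WalkIn G Q u w
  walk-mono P⊆Q (stop pu)          = stop (P⊆Q pu)
  walk-mono P⊆Q (step pu u~v walk) = step (P⊆Q pu) u~v (walk-mono P⊆Q walk)

  walk-snoc : ∀ {P : Fin n → Set} {u v w} → WalkIn G P u v → Adj G v w → P w → WalkIn G P u w
  walk-snoc (stop pu)          v~w pw = step pu v~w (stop pw)
  walk-snoc (step pu u~v walk) v~w pw = step pu u~v (walk-snoc walk v~w pw)

  crossing-edge : ∀ {P S : Fin n → Set} → Decidable S → ∀ {u w} → WalkIn G P u w → S u → ¬ S w →
                  ∃₂ λ a b → S a × ¬ S b × Adj G a b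
  crossing-edge S? (stop _) su ¬sw = contradiction su ¬sw
  crossing-edge S? (step {v = v} _ u~v walk) su ¬sw with S? v
  ... | yes sv = crossing-edge S? walk sv ¬sw
  ... | no ¬sv = _ , v , su , ¬sv , u~v

  connectedOn-extend : ∀ {S a t} → ConnectedOn G S → S a → Adj G a t → ConnectedOn G (S ∪ ｛ t ｝)
  connectedOn-extend conn sa a~t u v (inj₁ su) (inj₁ sv) =
    walk-mono inj₁ (conn u v su sv)
  connectedOn-extend conn sa a~t u _ (inj₁ su) (inj₂ refl) =
    walk-snoc (walk-mono inj₁ (conn u _ su sa)) a~t (inj₂ refl)
  connectedOn-extend conn sa a~t _ v (inj₂ refl) (inj₁ sv) =
    step (inj₂ refl) (adj-sym G a~t) (walk-mono inj₁ (conn _ v sa sv))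
  connectedOn-extend conn sa a~t _ _ (inj₂ refl) (inj₂ refl) = stop (inj₂ refl)

minus2? : ∀ {n} (x y : Fin n) → Decidable (Minus2 x y)
minus2? x y v = ¬? (v ≟ x) ×-dec ¬? (v ≟ y)

record Candidate {n} (G : SimpleGraph n) : Set₁ where
  field
    x y       : Fin n
    x~y       : Adj G x y
    S         : Fin n → Set
    S?        : Decidable S
    root      : Fin n
    root∈S    : S root
    connected : ConnectedOn G S
    avoids    : ∀ {v} → S v → Minus2 x y v

GoodEdge : ∀ {n} → SimpleGraph n → Set
GoodEdge {n} G = Σ (Fin n) λ x → Σ (Fin n) λ y → Adj G x y × ConnectedOn G (Minus2 x y)

module _ {n} {G : SimpleGraph n} where

  gap : Candidate G → ℕ
  gap c = length (filter (∁? S?) (allFin n))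
    where open Candidate c

  _⊏_ : Candidate G → Candidate G → Set
  c′ ⊏ c = gap c′ < gap c

  module _ (c : Candidate G) where
    open Candidate c

    insert-candidate : ∀ {p q t a} → Adj G p q → ¬ S t → S a → Adj G a t →
                       (∀ {v} → S v → Minus2 p q v) → Minus2 p q t → Σ (Candidate G) (_⊏ c)
    insert-candidate {p} {q} {t} {a} p~q t∉S a∈S a~t S-avoids t-avoids =
      record
        { x = p ; y = q ; x~y = p~q
        ; S = S ∪ ｛ t ｝ ; S? = S? ∪? (t ≟_)
        ; root = t ; root∈S = inj₂ refl
        ; connected = connectedOn-extend connected a∈S a~t
        ; avoids = λ { (inj₁ sv) → S-avoids sv ; (inj₂ refl) → t-avoids }
        }
      , length-filter-strict (∁? (S? ∪? (t ≟_))) (∁? S?) (λ v∉S∪t v∈S → v∉S∪t (inj₁ v∈S))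
          (∈-allFin t) t∉S (λ t∉S∪t → t∉S∪t (inj₂ refl))

    complete : (∀ {v} → Minus2 x y v → S v) → GoodEdge G
    complete covers = x , y , x~y , λ u v u∉xy v∉xy →
      walk-mono avoids (connected u v (covers u∉xy) (covers v∉xy))

    extend-across : ∀ {a b z} → S a → ¬ S b → Adj G a b → ¬ S z → Minus2 x y z → 2 ≤ degree G z →
                    Σ (Candidate G) (_⊏ c)
    extend-across {b = b} {z} a∈S b∉S a~b z∉S z∉xy deg-z with minus2? x y b
    ... | yes b∉xy = insert-candidate x~y b∉S a∈S a~b avoids b∉xy
    ... | no b∈xy with other-neighbour G deg-z b
    ...   | w , z~w , w≢b with S? w
    ...     | yes w∈S = insert-candidate x~y z∉S w∈S (adj-sym G z~w) avoids z∉xy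
    ...     | no w∉S = insert-candidate z~w b∉S a∈S a~b
                (λ v∈S → (λ { refl → z∉S v∈S }) , λ { refl → w∉S v∈S })
                ((λ { refl → b∈xy z∉xy }) , λ b≡w → w≢b (sym b≡w))

    improve : Connected G → (∀ v → 2 ≤ degree G v) → GoodEdge G ⊎ Σ (Candidate G) (_⊏ c)
    improve conn deg with any? (λ z → ¬? (S? z) ×-dec minus2? x y z)
    ... | no none-left = inj₁ (complete λ {v} v∉xy →
      decidable-stable (S? v) λ v∉S → none-left (v , v∉S , v∉xy))
    ... | yes (z , z∉S , z∉xy) =
      let a , b , a∈S , b∉S , a~b = crossing-edge S? (conn root z tt tt) root∈S z∉S
      in inj₂ (extend-across a∈S b∉S a~b z∉S z∉xy (deg z))

  search : Connected G → (∀ v → 2 ≤ degree G v) → (c : Candidate G) → Acc _⊏_ c → GoodEdge G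
  search conn deg c (acc rs) with improve c conn deg
  ... | inj₁ good         = good
  ... | inj₂ (c′ , c′⊏c) = search conn deg c′ (rs c′⊏c)

  initial-candidate : (∀ v → 2 ≤ degree G v) → Fin n → Candidate G
  initial-candidate deg v with other-neighbour G (deg v) v
  ... | a , v~a , _ with other-neighbour G (deg v) a
  ...   | b , v~b , b≢a = record
    { x = v ; y = a ; x~y = v~a
    ; S = ｛ b ｝ ; S? = b ≟_
    ; root = b ; root∈S = refl
    ; connected = λ { _ _ refl refl → stop refl }
    ; avoids = λ { refl → (λ b≡v → adj-irrefl G v~b (sym b≡v)) , b≢a }
    }

lemma8 : (n : ℕ) (G : SimpleGraph n) → 1 ≤ n → Connected G → (∀ v → 2 ≤ degree G v) →
    Σ (Fin n) λ x → Σ (Fin n) λ y → Adj G x y × ConnectedOn G (Minus2 x y)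
lemma8 (suc _) G _ conn deg =
  search conn deg (initial-candidate deg zero) (wellFounded gap <-wellFounded _)
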